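{- Let $G$ be a bipartite permutation graph and let $I$ and $J$ be maximum independent sets of $G$. Suppose that there is a reconfiguration sequence between $I$ and $J$. Then there is a reconfiguration sequence of length $|I\setminus J|$ between $I$ and $J$.
   Context: A graph $G=(V,E)$ with $V=[n]$ is a permutation graph if there is a permutation $\pi:[n]\to[n]$ such that for $1\le i<j\le n$, $\{i,j\}\in E$ if and only if $\pi(i)>\pi(j)$. A reconfiguration sequence between independent sets $I$ and $J$ of $G$ is a sequence of independent sets $I_0=I,I_1,\dots,I_\ell=J$ such that for each $1\le t\le\ell$, $I_t\setminus I_{t-1}=\{v\}$ and $I_{t-1}\setminus I_t=\{u\}$ for some vertices $u,v$; its length is $\ell$. -}

module Defs where

open import Data.Nat using (ℕ; zero; suc)
open import Data.Bool using (Bool)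
open import Data.Fin using (Fin; _<_)
open import Data.Fin.Subset using (Subset; _∈_; _─_; ⁅_⁆; ∣_∣)
open import Data.Fin.Permutation using (Permutation′; _⟨$⟩ʳ_)
open import Data.Product using (Σ; ∃; ∃₂; _×_; _,_)
open import Relation.Binary.PropositionalEquality using (_≡_; _≢_)
open import Relation.Nullary using (¬_)

Edge : ∀ {n} → Permutation′ n → Fin n → Fin n → Set
Edge π i j = (i < j × (π ⟨$⟩ʳ j) < (π ⟨$⟩ʳ i))
           Data.Sum.⊎ (j < i × (π ⟨$⟩ʳ i) < (π ⟨$⟩ʳ j))
  where import Data.Sum

Bipartite : ∀ {n} → Permutation′ n → Set
Bipartite {n} π = Σ (Fin n → Bool) λ c → ∀ i j → Edge π i j → c i ≢ c j

Independent : ∀ {n} → Permutation′ n → Subset n → Set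
Independent π S = ∀ i j → i ∈ S → j ∈ S → ¬ Edge π i j

MaximumIndependent : ∀ {n} → Permutation′ n → Subset n → Set
MaximumIndependent π S =
  Independent π S × (∀ T → Independent π T → ∣ T ∣ Data.Nat.≤ ∣ S ∣)
  where import Data.Nat

-- One token-jumping step: J ∖ I = {v} and I ∖ J = {u} for some u, v.
Step : ∀ {n} → Subset n → Subset n → Set
Step I J = ∃₂ λ u v → (J ─ I ≡ ⁅ v ⁆) × (I ─ J ≡ ⁅ u ⁆)

data ReconfSeq {n} (π : Permutation′ n) : Subset n → Subset n → ℕ → Set where
  done : ∀ {I} → Independent π I → ReconfSeq π I I zero
  step : ∀ {I I′ J ℓ} → Independent π I → Step I I′ →
         ReconfSeq π I′ J ℓ → ReconfSeq π I J (suc ℓ)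

-- Independent sets of G_π are the increasing subsequences of π. In a maximum independent set I
-- a token move u ↦ v is along an edge, and u has as many elements of I before it as v has of the
-- new set. If neither u nor v is in a maximum independent set J, the element of J with that same
-- rank is adjacent to both (otherwise splicing the beginning of one set with the end of the other
-- gives a longer increasing subsequence): a triangle in a bipartite graph. So every move of a
-- sequence ending at J either brings a vertex of J in, or replaces some u ∈ J by v ∉ J; in the
-- latter case a shortest sequence from the new set must later move the token on v to u, and the
-- two moves cancel. Induction along the given sequence yields one of length ∣I ─ J∣, which is
-- optimal because a move changes ∣I ─ J∣ by at most one.

module Submission where

open import Defs
open import Data.Bool.Properties using (¬-not)
open import Data.Empty using (⊥-elim)
open import Data.Fin.Base using (Fin; zero; suc; _<_)
open import Data.Fin.Properties using (_≟_; <-cmp; <-asym; <-trans; <-irrefl; <⇒≢)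
open import Data.Fin.Permutation using (Permutation′; _⟨$⟩ʳ_; _⟨$⟩ˡ_; inverseˡ)
open import Data.Fin.Subset
open import Data.Fin.Subset.Properties
import Data.Nat.Base as ℕ
open import Data.Nat.Base using (ℕ; zero; suc; _+_; _≤_; s≤s; z<s; s<s; s≤s⁻¹)
open import Data.Nat.Properties
  using ( +-suc; +-comm; +-identityʳ; +-cancelʳ-≡; +-cancelʳ-≤; +-monoʳ-≤; m≤m+n; 1+n≰n
        ; ≤-antisym; ≤-trans; ≤-reflexive; module ≤-Reasoning)
open import Data.Product.Base using (Σ; ∃; ∃₂; _×_; _,_; proj₁; proj₂)
open import Data.Sum.Base using (_⊎_; inj₁; inj₂; [_,_]′; swap)
open import Data.Vec.Base using ([]; _∷_; here; there)
open import Function.Base using (_∘_)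
open import Relation.Binary.Definitions using (tri<; tri≈; tri>)
open import Relation.Binary.PropositionalEquality
  using (_≡_; _≢_; refl; sym; trans; cong; cong₂; subst; ≢-sym; module ≡-Reasoning)
open import Relation.Nullary using (¬_; yes; no)
open import Relation.Nullary.Decidable using (decidable-stable)

private
  variable
    n : ℕ
    p q r J K K′ K₁ K₂ : Subset n
    ℓ : ℕ
    a b u v x y : Fin n

∈∉⇒≢ : x ∈ p → y ∉ p → x ≢ y
∈∉⇒≢ x∈p y∉p refl = y∉p x∈p

x∈p─q⁻ : ∀ (p q : Subset n) → x ∈ p ─ q → x ∈ p × x ∉ q
x∈p─q⁻ (inside  ∷ p) (outside ∷ q) here = here , λ ()
x∈p─q⁻ {x = zero} (inside  ∷ p) (inside  ∷ q) ()
x∈p─q⁻ {x = zero} (outside ∷ p) (outside ∷ q) ()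
x∈p─q⁻ {x = zero} (outside ∷ p) (inside  ∷ q) ()
x∈p─q⁻ (s ∷ p) (t ∷ q) (there x∈p─q) with x∈p─q⁻ p q x∈p─q
... | x∈p , x∉q = there x∈p , λ x∈tq → x∉q (drop-there x∈tq)

Empty⇒∣p∣≡0 : Empty p → ∣ p ∣ ≡ 0
Empty⇒∣p∣≡0 {n} e = trans (cong ∣_∣ (Empty-unique e)) (∣⊥∣≡0 n)

∣p─p∣≡0 : ∀ (p : Subset n) → ∣ p ─ p ∣ ≡ 0
∣p─p∣≡0 p = Empty⇒∣p∣≡0 λ (_ , x∈) → let x∈p , x∉p = x∈p─q⁻ p p x∈ in x∉p x∈p

∣p∣≡∣p∩q∣+∣p─q∣ : ∀ (p q : Subset n) → ∣ p ∣ ≡ ∣ p ∩ q ∣ + ∣ p ─ q ∣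
∣p∣≡∣p∩q∣+∣p─q∣ []            []            = refl
∣p∣≡∣p∩q∣+∣p─q∣ (inside  ∷ p) (inside  ∷ q) = cong suc (∣p∣≡∣p∩q∣+∣p─q∣ p q)
∣p∣≡∣p∩q∣+∣p─q∣ (inside  ∷ p) (outside ∷ q) =
  trans (cong suc (∣p∣≡∣p∩q∣+∣p─q∣ p q)) (sym (+-suc _ _))
∣p∣≡∣p∩q∣+∣p─q∣ (outside ∷ p) (inside  ∷ q) = ∣p∣≡∣p∩q∣+∣p─q∣ p q
∣p∣≡∣p∩q∣+∣p─q∣ (outside ∷ p) (outside ∷ q) = ∣p∣≡∣p∩q∣+∣p─q∣ p q

∣p∪q─r∣≡∣p─r∣+∣q─r∣ : ∀ (p q r : Subset n) → Empty (p ∩ q) →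
                     ∣ p ∪ q ─ r ∣ ≡ ∣ p ─ r ∣ + ∣ q ─ r ∣
∣p∪q─r∣≡∣p─r∣+∣q─r∣ []            []            []            _ = refl
∣p∪q─r∣≡∣p─r∣+∣q─r∣ (inside  ∷ p) (inside  ∷ q) (_       ∷ r) e = ⊥-elim (e (zero , here))
∣p∪q─r∣≡∣p─r∣+∣q─r∣ (s       ∷ p) (t       ∷ q) (inside  ∷ r) e =
  ∣p∪q─r∣≡∣p─r∣+∣q─r∣ p q r (drop-∷-Empty e)
∣p∪q─r∣≡∣p─r∣+∣q─r∣ (inside  ∷ p) (outside ∷ q) (outside ∷ r) e =
  cong suc (∣p∪q─r∣≡∣p─r∣+∣q─r∣ p q r (drop-∷-Empty e))
∣p∪q─r∣≡∣p─r∣+∣q─r∣ (outside ∷ p) (inside  ∷ q) (outside ∷ r) e =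
  trans (cong suc (∣p∪q─r∣≡∣p─r∣+∣q─r∣ p q r (drop-∷-Empty e))) (sym (+-suc _ _))
∣p∪q─r∣≡∣p─r∣+∣q─r∣ (outside ∷ p) (outside ∷ q) (outside ∷ r) e =
  ∣p∪q─r∣≡∣p─r∣+∣q─r∣ p q r (drop-∷-Empty e)

∣p∪q∣≡∣p∣+∣q∣ : ∀ (p q : Subset n) → Empty (p ∩ q) → ∣ p ∪ q ∣ ≡ ∣ p ∣ + ∣ q ∣
∣p∪q∣≡∣p∣+∣q∣ p q e = begin
  ∣ p ∪ q ∣              ≡⟨ cong ∣_∣ (p─⊥≡p (p ∪ q)) ⟨
  ∣ p ∪ q ─ ⊥ ∣          ≡⟨ ∣p∪q─r∣≡∣p─r∣+∣q─r∣ p q ⊥ e ⟩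
  ∣ p ─ ⊥ ∣ + ∣ q ─ ⊥ ∣  ≡⟨ cong₂ _+_ (cong ∣_∣ (p─⊥≡p p)) (cong ∣_∣ (p─⊥≡p q)) ⟩
  ∣ p ∣ + ∣ q ∣          ∎
  where open ≡-Reasoning

x∉p⇒Empty[p∩⁅x⁆] : x ∉ p → Empty (p ∩ ⁅ x ⁆)
x∉p⇒Empty[p∩⁅x⁆] {x = x} {p} x∉p (y , y∈) =
  let y∈p , y∈⁅x⁆ = x∈p∩q⁻ p ⁅ x ⁆ y∈ in x∉p (subst (_∈ p) (x∈⁅y⁆⇒x≡y x y∈⁅x⁆) y∈p)

∣p∪⁅x⁆∣≡1+∣p∣ : x ∉ p → ∣ p ∪ ⁅ x ⁆ ∣ ≡ suc ∣ p ∣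
∣p∪⁅x⁆∣≡1+∣p∣ {x = x} {p} x∉p =
  trans (∣p∪q∣≡∣p∣+∣q∣ p ⁅ x ⁆ (x∉p⇒Empty[p∩⁅x⁆] x∉p))
        (trans (cong (∣ p ∣ +_) (∣⁅x⁆∣≡1 x)) (+-comm ∣ p ∣ 1))

∣⁅x⁆─p∣≡0 : x ∈ p → ∣ ⁅ x ⁆ ─ p ∣ ≡ 0
∣⁅x⁆─p∣≡0 {x = x} {p} x∈p = Empty⇒∣p∣≡0 λ (y , y∈) →
  let y∈⁅x⁆ , y∉p = x∈p─q⁻ ⁅ x ⁆ p y∈ in y∉p (subst (_∈ p) (sym (x∈⁅y⁆⇒x≡y x y∈⁅x⁆)) x∈p)

∣⁅x⁆─p∣≡1 : x ∉ p → ∣ ⁅ x ⁆ ─ p ∣ ≡ 1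
∣⁅x⁆─p∣≡1 {x = x} {p} x∉p = trans (cong ∣_∣ ⁅x⁆─p≡⁅x⁆) (∣⁅x⁆∣≡1 x)
  where
  ⁅x⁆─p≡⁅x⁆ : ⁅ x ⁆ ─ p ≡ ⁅ x ⁆
  ⁅x⁆─p≡⁅x⁆ = ⊆-antisym (p─q⊆p ⁅ x ⁆ p) λ y∈⁅x⁆ →
    subst (_∈ ⁅ x ⁆ ─ p) (sym (x∈⁅y⁆⇒x≡y x y∈⁅x⁆)) (x∈p∧x∉q⇒x∈p─q (x∈⁅x⁆ x) x∉p)

∣⁅x⁆─p∣≤1 : ∀ (x : Fin n) p → ∣ ⁅ x ⁆ ─ p ∣ ≤ 1
∣⁅x⁆─p∣≤1 x p = ≤-trans (∣p─q∣≤∣p∣ ⁅ x ⁆ p) (≤-reflexive (∣⁅x⁆∣≡1 x))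

record Exchange (K : Subset n) (u v : Fin n) (K′ : Subset n) : Set where
  field
    out∈  : u ∈ K
    out∉  : u ∉ K′
    in∉   : v ∉ K
    in∈   : v ∈ K′
    kept  : x ≢ u → x ≢ v → x ∈ K → x ∈ K′
    kept⁻ : x ≢ u → x ≢ v → x ∈ K′ → x ∈ K

open Exchange

exchange-sym : Exchange K u v K′ → Exchange K′ v u K
exchange-sym ex = record
  { out∈ = in∈ ex ; out∉ = in∉ ex ; in∉ = out∉ ex ; in∈ = out∈ ex
  ; kept = λ x≢v x≢u → kept⁻ ex x≢u x≢v ; kept⁻ = λ x≢v x≢u → kept ex x≢u x≢v }

exchange-≢ : Exchange K u v K′ → u ≢ v
exchange-≢ ex = ∈∉⇒≢ (out∈ ex) (in∉ ex)

step⇒exchange : Step K K′ → ∃₂ λ u v → Exchange K u v K′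
step⇒exchange {K = K} {K′} (u , v , K′─K≡⁅v⁆ , K─K′≡⁅u⁆) = u , v , record
  { out∈  = proj₁ u∈K─K′ ; out∉ = proj₂ u∈K─K′ ; in∉ = proj₂ v∈K′─K ; in∈ = proj₁ v∈K′─K
  ; kept  = λ x≢u _ x∈K → decidable-stable (_ ∈? K′) λ x∉K′ →
              x≢u (x∈⁅y⁆⇒x≡y u (subst (_ ∈_) K─K′≡⁅u⁆ (x∈p∧x∉q⇒x∈p─q x∈K x∉K′)))
  ; kept⁻ = λ _ x≢v x∈K′ → decidable-stable (_ ∈? K) λ x∉K →
              x≢v (x∈⁅y⁆⇒x≡y v (subst (_ ∈_) K′─K≡⁅v⁆ (x∈p∧x∉q⇒x∈p─q x∈K′ x∉K))) }
  where
  u∈K─K′ = x∈p─q⁻ K K′ (subst (u ∈_) (sym K─K′≡⁅u⁆) (x∈⁅x⁆ u))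
  v∈K′─K = x∈p─q⁻ K′ K (subst (v ∈_) (sym K′─K≡⁅v⁆) (x∈⁅x⁆ v))

exchange-─ : Exchange K u v K′ → K ─ K′ ≡ ⁅ u ⁆
exchange-─ {K = K} {u} {K′ = K′} ex = ⊆-antisym
  (λ x∈K─K′ → let x∈K , x∉K′ = x∈p─q⁻ K K′ x∈K─K′ in
    decidable-stable (_ ∈? ⁅ u ⁆) λ x∉⁅u⁆ →
      x∉K′ (kept ex (x∉⁅y⁆⇒x≢y x∉⁅u⁆) (∈∉⇒≢ x∈K (in∉ ex)) x∈K))
  (λ x∈⁅u⁆ → subst (_∈ K ─ K′) (sym (x∈⁅y⁆⇒x≡y u x∈⁅u⁆)) (x∈p∧x∉q⇒x∈p─q (out∈ ex) (out∉ ex)))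

exchange⇒step : Exchange K u v K′ → Step K K′
exchange⇒step {u = u} {v} ex = u , v , exchange-─ (exchange-sym ex) , exchange-─ ex

exchange-⊆ : Exchange K u v K₁ → Exchange K u v K₂ → K₁ ⊆ K₂
exchange-⊆ {v = v} ex₁ ex₂ {x} x∈K₁ with x ≟ v
... | yes refl = in∈ ex₂
... | no x≢v   = kept ex₂ x≢u x≢v (kept⁻ ex₁ x≢u x≢v x∈K₁)
  where x≢u = ∈∉⇒≢ x∈K₁ (out∉ ex₁)

exchange-unique : Exchange K u v K₁ → Exchange K u v K₂ → K₁ ≡ K₂
exchange-unique ex₁ ex₂ = ⊆-antisym (exchange-⊆ ex₁ ex₂) (exchange-⊆ ex₂ ex₁)

exchange-∪ : Exchange K u v K′ → K ∪ ⁅ v ⁆ ⊆ K′ ∪ ⁅ u ⁆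
exchange-∪ {K = K} {u} {v} {K′} ex {x} x∈ with x∈p∪q⁻ K ⁅ v ⁆ x∈
... | inj₂ x∈⁅v⁆ = subst (_∈ K′ ∪ ⁅ u ⁆) (sym (x∈⁅y⁆⇒x≡y v x∈⁅v⁆)) (x∈p∪q⁺ (inj₁ (in∈ ex)))
... | inj₁ x∈K with x ≟ u
...   | yes refl = x∈p∪q⁺ (inj₂ (x∈⁅x⁆ u))
...   | no x≢u   = x∈p∪q⁺ (inj₁ (kept ex x≢u (∈∉⇒≢ x∈K (in∉ ex)) x∈K))

exchange-∣─∣ : Exchange K u v K′ → ∀ J → ∣ K ─ J ∣ + ∣ ⁅ v ⁆ ─ J ∣ ≡ ∣ K′ ─ J ∣ + ∣ ⁅ u ⁆ ─ J ∣
exchange-∣─∣ {K = K} {u} {v} {K′} ex J = begin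
  ∣ K ─ J ∣ + ∣ ⁅ v ⁆ ─ J ∣   ≡⟨ ∣p∪q─r∣≡∣p─r∣+∣q─r∣ K ⁅ v ⁆ J (x∉p⇒Empty[p∩⁅x⁆] (in∉ ex)) ⟨
  ∣ K ∪ ⁅ v ⁆ ─ J ∣          ≡⟨ cong (λ S → ∣ S ─ J ∣) K∪⁅v⁆≡K′∪⁅u⁆ ⟩
  ∣ K′ ∪ ⁅ u ⁆ ─ J ∣         ≡⟨ ∣p∪q─r∣≡∣p─r∣+∣q─r∣ K′ ⁅ u ⁆ J (x∉p⇒Empty[p∩⁅x⁆] (out∉ ex)) ⟩
  ∣ K′ ─ J ∣ + ∣ ⁅ u ⁆ ─ J ∣  ∎
  where
  open ≡-Reasoning
  K∪⁅v⁆≡K′∪⁅u⁆ = ⊆-antisym (exchange-∪ ex) (exchange-∪ (exchange-sym ex))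

exchange-∣∣ : Exchange K u v K′ → ∣ K ∣ ≡ ∣ K′ ∣
exchange-∣∣ {K = K} {u} {v} {K′} ex = +-cancelʳ-≡ 1 ∣ K ∣ ∣ K′ ∣ (begin
  ∣ K ∣ + 1                  ≡⟨ cong₂ _+_ (cong ∣_∣ (p─⊥≡p K)) (∣⁅x⁆─p∣≡1 {x = v} ∉⊥) ⟨
  ∣ K ─ ⊥ ∣ + ∣ ⁅ v ⁆ ─ ⊥ ∣  ≡⟨ exchange-∣─∣ ex ⊥ ⟩
  ∣ K′ ─ ⊥ ∣ + ∣ ⁅ u ⁆ ─ ⊥ ∣ ≡⟨ cong₂ _+_ (cong ∣_∣ (p─⊥≡p K′)) (∣⁅x⁆─p∣≡1 {x = u} ∉⊥) ⟩
  ∣ K′ ∣ + 1                 ∎)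
  where open ≡-Reasoning

replace : Subset n → Fin n → Fin n → Subset n
replace K u v = (K - u) ∪ ⁅ v ⁆

∈-replace⁻ : ∀ K → x ∈ replace K u v → (x ∈ K × x ≢ u) ⊎ x ≡ v
∈-replace⁻ {u = u} {v} K x∈ with x∈p∪q⁻ (K - u) ⁅ v ⁆ x∈
... | inj₁ x∈K-u  = let x∈K , x∉⁅u⁆ = x∈p─q⁻ K ⁅ u ⁆ x∈K-u in inj₁ (x∈K , x∉⁅y⁆⇒x≢y x∉⁅u⁆)
... | inj₂ x∈⁅v⁆ = inj₂ (x∈⁅y⁆⇒x≡y v x∈⁅v⁆)

∈-replace⁺ : x ∈ K → x ≢ u → x ∈ replace K u v
∈-replace⁺ x∈K x≢u = x∈p∪q⁺ (inj₁ (x∈p∧x≢y⇒x∈p-y x∈K x≢u))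

in∈replace : ∀ K (u v : Fin n) → v ∈ replace K u v
in∈replace K u v = x∈p∪q⁺ (inj₂ (x∈⁅x⁆ v))

exchange-replace : u ∈ K → v ∉ K → Exchange K u v (replace K u v)
exchange-replace {u = u} {K} {v} u∈K v∉K = record
  { out∈ = u∈K
  ; out∉ = λ u∈ → [ (λ (_ , u≢u) → u≢u refl) , (λ u≡v → v∉K (subst (_∈ K) u≡v u∈K)) ]′
                    (∈-replace⁻ K u∈)
  ; in∉ = v∉K
  ; in∈ = in∈replace K u v
  ; kept = λ x≢u _ x∈K → ∈-replace⁺ x∈K x≢u
  ; kept⁻ = λ _ x≢v x∈ → [ proj₁ , (λ x≡v → ⊥-elim (x≢v x≡v)) ]′ (∈-replace⁻ K x∈) }

exchange-commute : Exchange K a b K₁ → Exchange K v u K′ → a ≢ v → b ≢ u →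
                   Exchange K₁ v u (replace K₁ v u) × Exchange K′ a b (replace K₁ v u)
exchange-commute {a = a} {b = b} {K₁ = K₁} {v = v} {u = u} {K′ = K′} ex₁ ex a≢v b≢u =
  exchange-replace v∈K₁ u∉K₁ , record
    { out∈  = kept ex a≢v a≢u (out∈ ex₁)
    ; out∉  = [ (λ (a∈K₁ , _) → out∉ ex₁ a∈K₁) , a≢u ]′ ∘ ∈-replace⁻ K₁
    ; in∉   = λ b∈K′ → in∉ ex₁ (kept⁻ ex b≢v b≢u b∈K′)
    ; in∈   = ∈-replace⁺ (in∈ ex₁) b≢v
    ; kept  = kept′
    ; kept⁻ = λ x≢a x≢b → [ kept⁻′ x≢a x≢b , (λ x≡u → subst (_∈ K′) (sym x≡u) (in∈ ex)) ]′
                            ∘ ∈-replace⁻ K₁ }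
  where
  a≢u = ∈∉⇒≢ (out∈ ex₁) (in∉ ex)
  b≢v = ≢-sym (∈∉⇒≢ (out∈ ex) (in∉ ex₁))
  v∈K₁ = kept ex₁ (≢-sym a≢v) (≢-sym b≢v) (out∈ ex)
  u∉K₁ = λ u∈K₁ → in∉ ex (kept⁻ ex₁ (≢-sym a≢u) (≢-sym b≢u) u∈K₁)
  kept′ : x ≢ a → x ≢ b → x ∈ K′ → x ∈ replace K₁ v u
  kept′ {x = x} x≢a x≢b x∈K′ with x ≟ u
  ... | yes refl = in∈replace K₁ v u
  ... | no x≢u   = ∈-replace⁺ (kept ex₁ x≢a x≢b (kept⁻ ex x≢v x≢u x∈K′)) x≢v
    where x≢v = ∈∉⇒≢ x∈K′ (out∉ ex)
  kept⁻′ : x ≢ a → x ≢ b → x ∈ K₁ × x ≢ v → x ∈ K′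
  kept⁻′ x≢a x≢b (x∈K₁ , x≢v) = kept ex x≢v (∈∉⇒≢ x∈K₁ u∉K₁) (kept⁻ ex₁ x≢a x≢b x∈K₁)

distance-step : Exchange K u v K′ → ∣ K ─ J ∣ ≤ suc ∣ K′ ─ J ∣
distance-step {K = K} {u} {v} {K′} {J} ex = begin
  ∣ K ─ J ∣                   ≤⟨ m≤m+n ∣ K ─ J ∣ _ ⟩
  ∣ K ─ J ∣ + ∣ ⁅ v ⁆ ─ J ∣   ≡⟨ exchange-∣─∣ ex J ⟩
  ∣ K′ ─ J ∣ + ∣ ⁅ u ⁆ ─ J ∣  ≤⟨ +-monoʳ-≤ ∣ K′ ─ J ∣ (∣⁅x⁆─p∣≤1 u J) ⟩
  ∣ K′ ─ J ∣ + 1              ≡⟨ +-comm ∣ K′ ─ J ∣ 1 ⟩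
  suc ∣ K′ ─ J ∣              ∎
  where open ≤-Reasoning

distance-decrease : Exchange K u v K′ → u ∉ J → v ∈ J → ∣ K ─ J ∣ ≡ suc ∣ K′ ─ J ∣
distance-decrease {K = K} {u} {v} {K′} {J} ex u∉J v∈J = begin
  ∣ K ─ J ∣                   ≡⟨ +-identityʳ ∣ K ─ J ∣ ⟨
  ∣ K ─ J ∣ + 0               ≡⟨ cong (∣ K ─ J ∣ +_) (∣⁅x⁆─p∣≡0 v∈J) ⟨
  ∣ K ─ J ∣ + ∣ ⁅ v ⁆ ─ J ∣   ≡⟨ exchange-∣─∣ ex J ⟩
  ∣ K′ ─ J ∣ + ∣ ⁅ u ⁆ ─ J ∣  ≡⟨ cong (∣ K′ ─ J ∣ +_) (∣⁅x⁆─p∣≡1 u∉J) ⟩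
  ∣ K′ ─ J ∣ + 1              ≡⟨ +-comm ∣ K′ ─ J ∣ 1 ⟩
  suc ∣ K′ ─ J ∣              ∎
  where open ≡-Reasoning

distance-decrease⁻ : Exchange K u v K′ → ∣ K ─ J ∣ ≡ suc ∣ K′ ─ J ∣ → u ∉ J × v ∈ J
distance-decrease⁻ {K = K} {u} {v} {K′} {J} ex d≡1+d′ =
  (λ u∈J → 1+n≰n (subst (_≤ ∣ K′ ─ J ∣) d≡1+d′ (d≤d′-if-u∈J u∈J))) ,
  decidable-stable (v ∈? J) (λ v∉J → 1+n≰n (subst (_≤ ∣ K′ ─ J ∣) d≡1+d′ (d≤d′-if-v∉J v∉J)))
  where
  open ≤-Reasoning
  d≤d′-if-u∈J : u ∈ J → ∣ K ─ J ∣ ≤ ∣ K′ ─ J ∣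
  d≤d′-if-u∈J u∈J = begin
    ∣ K ─ J ∣                   ≤⟨ m≤m+n ∣ K ─ J ∣ _ ⟩
    ∣ K ─ J ∣ + ∣ ⁅ v ⁆ ─ J ∣   ≡⟨ exchange-∣─∣ ex J ⟩
    ∣ K′ ─ J ∣ + ∣ ⁅ u ⁆ ─ J ∣  ≡⟨ cong (∣ K′ ─ J ∣ +_) (∣⁅x⁆─p∣≡0 u∈J) ⟩
    ∣ K′ ─ J ∣ + 0              ≡⟨ +-identityʳ ∣ K′ ─ J ∣ ⟩
    ∣ K′ ─ J ∣                  ∎
  d≤d′-if-v∉J : v ∉ J → ∣ K ─ J ∣ ≤ ∣ K′ ─ J ∣
  d≤d′-if-v∉J v∉J = +-cancelʳ-≤ 1 ∣ K ─ J ∣ ∣ K′ ─ J ∣ (begin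
    ∣ K ─ J ∣ + 1               ≡⟨ cong (∣ K ─ J ∣ +_) (∣⁅x⁆─p∣≡1 v∉J) ⟨
    ∣ K ─ J ∣ + ∣ ⁅ v ⁆ ─ J ∣   ≡⟨ exchange-∣─∣ ex J ⟩
    ∣ K′ ─ J ∣ + ∣ ⁅ u ⁆ ─ J ∣  ≤⟨ +-monoʳ-≤ ∣ K′ ─ J ∣ (∣⁅x⁆─p∣≤1 u J) ⟩
    ∣ K′ ─ J ∣ + 1              ∎)

shortest-first-step : Exchange K a b K₁ → suc ℓ ≡ ∣ K ─ J ∣ → ∣ K₁ ─ J ∣ ≤ ℓ →
                      ℓ ≡ ∣ K₁ ─ J ∣ × a ∉ J × b ∈ J
shortest-first-step ex 1+ℓ≡d d₁≤ℓ = ℓ≡d₁ , distance-decrease⁻ ex (trans (sym 1+ℓ≡d) (cong suc ℓ≡d₁))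
  where ℓ≡d₁ = ≤-antisym (s≤s⁻¹ (subst (_≤ _) (sym 1+ℓ≡d) (distance-step ex))) d₁≤ℓ

below : Fin n → Subset n
below zero    = ⊥
below (suc x) = inside ∷ below x

∈below⇒< : x ∈ below y → x < y
∈below⇒< {y = zero}  x∈⊥          = ⊥-elim (∉⊥ x∈⊥)
∈below⇒< {y = suc y} here         = z<s
∈below⇒< {y = suc y} (there x∈↓y) = s<s (∈below⇒< x∈↓y)

<⇒∈below : x < y → x ∈ below y
<⇒∈below {x = zero}  {suc y} _         = here
<⇒∈below {x = suc x} {suc y} (s<s x<y) = there (<⇒∈below x<y)

rank : Subset n → Fin n → ℕ
rank S x = ∣ S ∩ below x ∣

rank<∣p∣ : x ∈ p → rank p x ℕ.< ∣ p ∣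
rank<∣p∣ {x = x} {p} x∈p = p⊂q⇒∣p∣<∣q∣ (p∩q⊆p p (below x) , x , x∈p , x∉p∩↓x)
  where x∉p∩↓x = λ x∈ → <-irrefl refl (∈below⇒< (proj₂ (x∈p∩q⁻ p (below x) x∈)))

rank-surjective : ∀ (p : Subset n) {m} → m ℕ.< ∣ p ∣ → ∃ λ x → x ∈ p × rank p x ≡ m
rank-surjective {suc n} (inside ∷ p) {zero} _ =
  zero , here , trans (cong ∣_∣ (∩-zeroʳ p)) (∣⊥∣≡0 n)
rank-surjective (inside ∷ p) {suc m} (s<s m<∣p∣) =
  let x , x∈p , rank≡m = rank-surjective p m<∣p∣ in suc x , there x∈p , cong suc rank≡m
rank-surjective (outside ∷ p) m<∣p∣ =
  let x , x∈p , rank≡m = rank-surjective p m<∣p∣ in suc x , there x∈p , rank≡m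

prefix : Subset n → Fin n → Subset n
prefix A a = A ∩ below a ∪ ⁅ a ⁆

suffix : Subset n → Fin n → Subset n
suffix B b = B ─ below b

∈-prefix⁻ : ∀ A → x ∈ prefix A a → (x ∈ A × x < a) ⊎ x ≡ a
∈-prefix⁻ {a = a} A x∈ with x∈p∪q⁻ (A ∩ below a) ⁅ a ⁆ x∈
... | inj₁ x∈A∩↓a = let x∈A , x∈↓a = x∈p∩q⁻ A (below a) x∈A∩↓a in inj₁ (x∈A , ∈below⇒< x∈↓a)
... | inj₂ x∈⁅a⁆  = inj₂ (x∈⁅y⁆⇒x≡y a x∈⁅a⁆)

∣prefix∣ : ∀ A (a : Fin n) → ∣ prefix A a ∣ ≡ suc (rank A a)
∣prefix∣ A a = ∣p∪⁅x⁆∣≡1+∣p∣ λ a∈ → <-irrefl refl (∈below⇒< (proj₂ (x∈p∩q⁻ A (below a) a∈)))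

∣p∣≡rank+∣suffix∣ : ∀ (p : Subset n) x → ∣ p ∣ ≡ rank p x + ∣ suffix p x ∣
∣p∣≡rank+∣suffix∣ p x = ∣p∣≡∣p∩q∣+∣p─q∣ p (below x)

splice : Subset n → Fin n → Subset n → Fin n → Subset n
splice A a B b = prefix A a ∪ suffix B b

∣splice∣ : ∀ A B → a < b → ∣ splice A a B b ∣ ≡ suc (rank A a + ∣ suffix B b ∣)
∣splice∣ {a = a} {b} A B a<b =
  trans (∣p∪q∣≡∣p∣+∣q∣ (prefix A a) (suffix B b) disjoint)
        (cong (_+ ∣ suffix B b ∣) (∣prefix∣ A a))
  where
  disjoint : Empty (prefix A a ∩ suffix B b)
  disjoint (x , x∈) =
    let x∈prefix , x∈suffix = x∈p∩q⁻ (prefix A a) (suffix B b) x∈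
        x<b = [ (λ (_ , x<a) → <-trans x<a a<b) , (λ x≡a → subst (_< b) (sym x≡a) a<b) ]′
                (∈-prefix⁻ A x∈prefix)
    in proj₂ (x∈p─q⁻ B (below b) x∈suffix) (<⇒∈below x<b)

module _ {n} (π : Permutation′ n) where

  private
    variable
      z : Fin n
      A B S T I I₁ : Subset n


  infix 4 _≺_
  _≺_ : Fin n → Fin n → Set
  x ≺ y = x < y × π ⟨$⟩ʳ x < π ⟨$⟩ʳ y

  ≺-trans : x ≺ y → y ≺ z → x ≺ z
  ≺-trans (x<y , πx<πy) (y<z , πy<πz) = <-trans x<y y<z , <-trans πx<πy πy<πz

  Comparable : Fin n → Fin n → Set
  Comparable x y = x ≺ y ⊎ y ≺ x

  π-injective : π ⟨$⟩ʳ x ≡ π ⟨$⟩ʳ y → x ≡ y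
  π-injective πx≡πy = trans (sym (inverseˡ π)) (trans (cong (π ⟨$⟩ˡ_) πx≡πy) (inverseˡ π))

  comparable⇒¬Edge : Comparable x y → ¬ Edge π x y
  comparable⇒¬Edge (inj₁ (_ , πx<πy)) (inj₁ (_ , πy<πx)) = <-asym πx<πy πy<πx
  comparable⇒¬Edge (inj₁ (x<y , _))   (inj₂ (y<x , _))   = <-asym x<y y<x
  comparable⇒¬Edge (inj₂ (y<x , _))   (inj₁ (x<y , _))   = <-asym x<y y<x
  comparable⇒¬Edge (inj₂ (_ , πy<πx)) (inj₂ (_ , πx<πy)) = <-asym πx<πy πy<πx

  ¬comparable⇒Edge : x ≢ y → ¬ Comparable x y → Edge π x y
  ¬comparable⇒Edge {x = x} {y} x≢y ¬x∼y with <-cmp x y | <-cmp (π ⟨$⟩ʳ x) (π ⟨$⟩ʳ y)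
  ... | tri≈ _ x≡y _   | _                = ⊥-elim (x≢y x≡y)
  ... | _              | tri≈ _ πx≡πy _   = ⊥-elim (x≢y (π-injective πx≡πy))
  ... | tri< x<y _ _   | tri< πx<πy _ _   = ⊥-elim (¬x∼y (inj₁ (x<y , πx<πy)))
  ... | tri< x<y _ _   | tri> _ _ πy<πx   = inj₁ (x<y , πy<πx)
  ... | tri> _ _ y<x   | tri< πx<πy _ _   = inj₂ (y<x , πx<πy)
  ... | tri> _ _ y<x   | tri> _ _ πy<πx   = ⊥-elim (¬x∼y (inj₂ (y<x , πy<πx)))

  Edge-irrefl : ¬ Edge π x x
  Edge-irrefl (inj₁ (x<x , _)) = <-irrefl refl x<x
  Edge-irrefl (inj₂ (x<x , _)) = <-irrefl refl x<x

  Edge-sym : Edge π x y → Edge π y x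
  Edge-sym = swap

  bipartite⇒triangle-free : Bipartite π → Edge π x y → Edge π y z → ¬ Edge π x z
  bipartite⇒triangle-free (colour , proper) xy yz xz =
    proper _ _ xz (trans (¬-not (proper _ _ xy)) (sym (¬-not (≢-sym (proper _ _ yz)))))

  Independent⇒≺ : Independent π S → x ∈ S → y ∈ S → x < y → x ≺ y
  Independent⇒≺ {x = x} {y = y} iS x∈S y∈S x<y with <-cmp (π ⟨$⟩ʳ x) (π ⟨$⟩ʳ y)
  ... | tri< πx<πy _ _ = x<y , πx<πy
  ... | tri≈ _ πx≡πy _ = ⊥-elim (<⇒≢ x<y (π-injective πx≡πy))
  ... | tri> _ _ πy<πx = ⊥-elim (iS x y x∈S y∈S (inj₁ (x<y , πy<πx)))

  Independent-⊆ : S ⊆ T → Independent π T → Independent π S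
  Independent-⊆ S⊆T iT i j i∈S j∈S = iT i j (S⊆T i∈S) (S⊆T j∈S)

  Independent-∪⁅⁆ : Independent π S → (∀ {x} → x ∈ S → ¬ Edge π x v) → Independent π (S ∪ ⁅ v ⁆)
  Independent-∪⁅⁆ {S = S} {v = v} iS compatible i j i∈ j∈
    with x∈p∪q⁻ S ⁅ v ⁆ i∈ | x∈p∪q⁻ S ⁅ v ⁆ j∈
  ... | inj₁ i∈S | inj₁ j∈S = iS i j i∈S j∈S
  ... | inj₁ i∈S | inj₂ j∈⁅v⁆ rewrite x∈⁅y⁆⇒x≡y v j∈⁅v⁆ = compatible i∈S
  ... | inj₂ i∈⁅v⁆ | inj₁ j∈S rewrite x∈⁅y⁆⇒x≡y v i∈⁅v⁆ = compatible j∈S ∘ Edge-sym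
  ... | inj₂ i∈⁅v⁆ | inj₂ j∈⁅v⁆
    rewrite x∈⁅y⁆⇒x≡y v i∈⁅v⁆ | x∈⁅y⁆⇒x≡y v j∈⁅v⁆ = Edge-irrefl

  Independent-replace : Independent π K → (∀ {x} → x ∈ K → x ≢ v → ¬ Edge π x u) →
                        Independent π (replace K v u)
  Independent-replace {K = K} {v = v} iK compatible =
    Independent-∪⁅⁆ (Independent-⊆ (p─q⊆p K ⁅ v ⁆) iK) λ x∈K-v →
      let x∈K , x∉⁅v⁆ = x∈p─q⁻ K ⁅ v ⁆ x∈K-v in compatible x∈K (x∉⁅y⁆⇒x≢y x∉⁅v⁆)

  maximum-dominates : MaximumIndependent π S → v ∉ S → ¬ (∀ {x} → x ∈ S → ¬ Edge π x v)
  maximum-dominates {S = S} {v = v} (iS , maximum) v∉S compatible = 1+n≰n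
    (subst (_≤ ∣ S ∣) (∣p∪⁅x⁆∣≡1+∣p∣ v∉S) (maximum (S ∪ ⁅ v ⁆) (Independent-∪⁅⁆ iS compatible)))

  exchange-maximum : MaximumIndependent π K → Independent π K′ → Exchange K u v K′ →
                     MaximumIndependent π K′
  exchange-maximum (_ , maximum) iK′ ex =
    iK′ , λ T iT → subst (∣ T ∣ ≤_) (exchange-∣∣ ex) (maximum T iT)

  exchange-Edge : MaximumIndependent π K → Independent π K′ → Exchange K u v K′ → Edge π u v
  exchange-Edge {K = K} {K′ = K′} {u = u} {v = v} mK iK′ ex =
    ¬comparable⇒Edge (exchange-≢ ex) λ u∼v → maximum-dominates mK (in∉ ex) (compatible u∼v)
    where
    compatible : Comparable u v → ∀ {x} → x ∈ K → ¬ Edge π x v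
    compatible u∼v {x} x∈K with x ≟ u
    ... | yes refl = comparable⇒¬Edge u∼v
    ... | no x≢u   = iK′ x v (kept ex x≢u (∈∉⇒≢ x∈K (in∉ ex)) x∈K) (in∈ ex)

  exchange-compatible : Independent π K′ → Exchange K a b K₁ → Exchange K v u K′ →
                        ¬ Edge π b u → x ∈ K₁ → x ≢ v → ¬ Edge π x u
  exchange-compatible {b = b} {u = u} {x = x} iK′ ex₁ ex ¬bu x∈K₁ x≢v
    with x ≟ b | x ≟ u
  ... | yes refl | _        = ¬bu
  ... | no _     | yes refl = Edge-irrefl
  ... | no x≢b   | no x≢u   =
    iK′ x u (kept ex x≢v x≢u (kept⁻ ex₁ (∈∉⇒≢ x∈K₁ (out∉ ex₁)) x≢b x∈K₁)) (in∈ ex)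

  ∈prefix⇒≼ : Independent π A → a ∈ A → x ∈ prefix A a → x ∈ A × (x ≡ a ⊎ x ≺ a)
  ∈prefix⇒≼ {A = A} iA a∈A x∈ with ∈-prefix⁻ A x∈
  ... | inj₁ (x∈A , x<a) = x∈A , inj₂ (Independent⇒≺ iA x∈A a∈A x<a)
  ... | inj₂ refl        = a∈A , inj₁ refl

  ∈suffix⇒≽ : Independent π B → b ∈ B → x ∈ suffix B b → x ∈ B × (x ≡ b ⊎ b ≺ x)
  ∈suffix⇒≽ {B = B} {b = b} {x = x} iB b∈B x∈ with x∈p─q⁻ B (below b) x∈ | <-cmp x b
  ... | _   , x∉↓b | tri< x<b _ _ = ⊥-elim (x∉↓b (<⇒∈below x<b))
  ... | x∈B , _    | tri≈ _ x≡b _ = x∈B , inj₁ x≡b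
  ... | x∈B , _    | tri> _ _ b<x = x∈B , inj₂ (Independent⇒≺ iB b∈B x∈B b<x)

  splice-Independent : Independent π A → Independent π B → a ∈ A → b ∈ B → a ≺ b →
                       Independent π (splice A a B b)
  splice-Independent {A = A} {B = B} {a = a} {b = b} iA iB a∈A b∈B a≺b i j i∈ j∈ =
    compatible (piece i∈) (piece j∈)
    where
    Piece : Fin n → Set
    Piece x = (x ∈ A × (x ≡ a ⊎ x ≺ a)) ⊎ (x ∈ B × (x ≡ b ⊎ b ≺ x))
    piece : x ∈ splice A a B b → Piece x
    piece x∈ = [ inj₁ ∘ ∈prefix⇒≼ iA a∈A , inj₂ ∘ ∈suffix⇒≽ iB b∈B ]′
                (x∈p∪q⁻ (prefix A a) (suffix B b) x∈)
    across : x ≡ a ⊎ x ≺ a → y ≡ b ⊎ b ≺ y → x ≺ y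
    across (inj₁ refl) (inj₁ refl) = a≺b
    across (inj₁ refl) (inj₂ b≺y)  = ≺-trans a≺b b≺y
    across (inj₂ x≺a)  (inj₁ refl) = ≺-trans x≺a a≺b
    across (inj₂ x≺a)  (inj₂ b≺y)  = ≺-trans x≺a (≺-trans a≺b b≺y)
    compatible : Piece x → Piece y → ¬ Edge π x y
    compatible (inj₁ (x∈A , _))  (inj₁ (y∈A , _))  = iA _ _ x∈A y∈A
    compatible (inj₁ (_ , x≼a)) (inj₂ (_ , b≼y)) = comparable⇒¬Edge (inj₁ (across x≼a b≼y))
    compatible (inj₂ (_ , b≼x)) (inj₁ (_ , y≼a)) = comparable⇒¬Edge (inj₂ (across y≼a b≼x))
    compatible (inj₂ (x∈B , _))  (inj₂ (y∈B , _))  = iB _ _ x∈B y∈B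

  equal-rank⇒¬≺ : Independent π A → MaximumIndependent π B → a ∈ A → b ∈ B →
                  rank A a ≡ rank B b → ¬ a ≺ b
  equal-rank⇒¬≺ {A = A} {B = B} {a = a} {b = b} iA (iB , maximum) a∈A b∈B rank≡ a≺b =
    1+n≰n (subst (_≤ ∣ B ∣) ∣splice∣≡1+∣B∣ (maximum _ (splice-Independent iA iB a∈A b∈B a≺b)))
    where
    open ≡-Reasoning
    ∣splice∣≡1+∣B∣ : ∣ splice A a B b ∣ ≡ suc ∣ B ∣
    ∣splice∣≡1+∣B∣ = begin
      ∣ splice A a B b ∣              ≡⟨ ∣splice∣ A B (proj₁ a≺b) ⟩
      suc (rank A a + ∣ suffix B b ∣) ≡⟨ cong (λ r → suc (r + ∣ suffix B b ∣)) rank≡ ⟩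
      suc (rank B b + ∣ suffix B b ∣) ≡⟨ cong suc (∣p∣≡rank+∣suffix∣ B b) ⟨
      suc ∣ B ∣                       ∎

  equal-rank⇒Edge : MaximumIndependent π A → MaximumIndependent π B → a ∈ A → b ∈ B → a ≢ b →
                    rank A a ≡ rank B b → Edge π a b
  equal-rank⇒Edge mA mB a∈A b∈B a≢b rank≡ = ¬comparable⇒Edge a≢b
    [ equal-rank⇒¬≺ (proj₁ mA) mB a∈A b∈B rank≡ , equal-rank⇒¬≺ (proj₁ mB) mA b∈B a∈A (sym rank≡) ]′

  exchange-below-⊆ : Independent π I → Independent π I₁ → Exchange I u v I₁ → Edge π u v →
                     I ∩ below u ⊆ I₁ ∩ below v
  exchange-below-⊆ {I = I} {I₁ = I₁} {u = u} {v = v} iI iI₁ ex uv {x} x∈ =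
    x∈p∩q⁺ (x∈I₁ , <⇒∈below x<v)
    where
    x∈I = proj₁ (x∈p∩q⁻ I (below u) x∈)
    x<u = ∈below⇒< (proj₂ (x∈p∩q⁻ I (below u) x∈))
    x∈I₁ = kept ex (<⇒≢ x<u) (∈∉⇒≢ x∈I (in∉ ex)) x∈I
    x<v : x < v
    x<v with <-cmp x v
    ... | tri< x<v _ _ = x<v
    ... | tri≈ _ x≡v _ = ⊥-elim (in∉ ex (subst (_∈ I) x≡v x∈I))
    ... | tri> _ _ v<x = ⊥-elim (comparable⇒¬Edge (inj₂ (≺-trans v≺x x≺u)) uv)
      where
      v≺x = Independent⇒≺ iI₁ (in∈ ex) x∈I₁ v<x
      x≺u = Independent⇒≺ iI x∈I (out∈ ex) x<u

  exchange-rank : Independent π I → Independent π I₁ → Exchange I u v I₁ → Edge π u v →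
                  rank I u ≡ rank I₁ v
  exchange-rank iI iI₁ ex uv = cong ∣_∣ (⊆-antisym
    (exchange-below-⊆ iI iI₁ ex uv) (exchange-below-⊆ iI₁ iI (exchange-sym ex) (Edge-sym uv)))

  maximum-∣∣ : MaximumIndependent π I → MaximumIndependent π J → ∣ I ∣ ≡ ∣ J ∣
  maximum-∣∣ {I = I} {J = J} (iI , I-maximum) (iJ , J-maximum) =
    ≤-antisym (J-maximum I iI) (I-maximum J iJ)

  no-exchange-outside : Bipartite π → MaximumIndependent π I → Independent π I₁ →
                        Exchange I u v I₁ → MaximumIndependent π J → ¬ (u ∉ J × v ∉ J)
  no-exchange-outside {I = I} {u = u} {J = J} bip mI iI₁ ex mJ (u∉J , v∉J)
    with rank-surjective J (subst (rank I u ℕ.<_) (maximum-∣∣ mI mJ) (rank<∣p∣ (out∈ ex)))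
  ... | w , w∈J , rank≡ = bipartite⇒triangle-free bip wu uv wv
    where
    uv = exchange-Edge mI iI₁ ex
    wu = equal-rank⇒Edge mJ mI w∈J (out∈ ex) (∈∉⇒≢ w∈J u∉J) rank≡
    wv = equal-rank⇒Edge mJ (exchange-maximum mI iI₁ ex) w∈J (in∈ ex) (∈∉⇒≢ w∈J v∉J)
           (trans rank≡ (exchange-rank (proj₁ mI) iI₁ ex uv))

  ReconfSeq⇒Independent : ReconfSeq π K J ℓ → Independent π K
  ReconfSeq⇒Independent (done iK)     = iK
  ReconfSeq⇒Independent (step iK _ _) = iK

  distance≤length : ReconfSeq π K J ℓ → ∣ K ─ J ∣ ≤ ℓ
  distance≤length {J = J} (done _)   = ≤-reflexive (∣p─p∣≡0 J)
  distance≤length (step _ st rest) =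
    let _ , _ , ex = step⇒exchange st in ≤-trans (distance-step ex) (s≤s (distance≤length rest))

  module _ (bip : Bipartite π) {J : Subset n} (mJ : MaximumIndependent π J) where

    -- K′ copies the moves of the shortest sequence from K; the first of them that takes v away
    -- must put it on u, and from there on the two sequences coincide.
    reroute : ReconfSeq π K J ℓ → ℓ ≡ ∣ K ─ J ∣ → MaximumIndependent π K → Independent π K′ →
              Exchange K v u K′ → v ∉ J → u ∈ J → ReconfSeq π K′ J ∣ K′ ─ J ∣
    reroute (done _) _ _ _ ex v∉J _ = ⊥-elim (v∉J (out∈ ex))
    reroute {K′ = K′} {v = v} {u = u} (step {I′ = K₁} iK st rest) 1+ℓ≡d mK iK′ ex v∉J u∈J
      with step⇒exchange st
    ... | a , b , ex₁ with shortest-first-step ex₁ 1+ℓ≡d (distance≤length rest) | a ≟ v | b ≟ u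
    ... | ℓ≡d₁ , _ , _ | yes refl | yes refl =
      subst (λ X → ReconfSeq π X J ∣ X ─ J ∣) (exchange-unique ex₁ ex)
        (subst (ReconfSeq π K₁ J) ℓ≡d₁ rest)
    ... | _ , _ , b∈J | yes refl | no b≢u =
      ⊥-elim (maximum-dominates (exchange-maximum mK (ReconfSeq⇒Independent rest) ex₁) u∉K₁
        λ x∈K₁ → exchange-compatible iK′ ex₁ ex ¬bu x∈K₁ (∈∉⇒≢ x∈K₁ (out∉ ex₁)))
      where
      ¬bu = proj₁ mJ b u b∈J u∈J
      u∉K₁ = λ u∈K₁ → in∉ ex (kept⁻ ex₁ (≢-sym (exchange-≢ ex)) (≢-sym b≢u) u∈K₁)
    ... | ℓ≡d₁ , a∉J , b∈J | no a≢v | _ =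
      subst (ReconfSeq π K′ J) (sym (distance-decrease (proj₂ commuted) a∉J b∈J))
        (step iK′ (exchange⇒step (proj₂ commuted))
          (reroute rest ℓ≡d₁ (exchange-maximum mK iK₁ ex₁) iK₁′ (proj₁ commuted) v∉J u∈J))
      where
      iK₁ = ReconfSeq⇒Independent rest
      v∈K₁ = kept ex₁ (≢-sym a≢v) (∈∉⇒≢ (out∈ ex) (in∉ ex₁)) (out∈ ex)
      b≢u : b ≢ u
      b≢u refl = iK₁ v b v∈K₁ (in∈ ex₁) (exchange-Edge mK iK′ ex)
      commuted = exchange-commute ex₁ ex a≢v b≢u
      iK₁′ = Independent-replace iK₁ (exchange-compatible iK′ ex₁ ex (proj₁ mJ b u b∈J u∈J))

    extend : MaximumIndependent π I → Independent π I₁ → Exchange I u v I₁ →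
             ReconfSeq π I₁ J ∣ I₁ ─ J ∣ → ReconfSeq π I J ∣ I ─ J ∣
    extend {I = I} {u = u} {v = v} mI iI₁ ex seq₁ with v ∈? J | u ∈? J
    ... | yes v∈J | _ =
      subst (ReconfSeq π I J) (sym (distance-decrease ex u∉J v∈J))
        (step (proj₁ mI) (exchange⇒step ex) seq₁)
      where u∉J = λ u∈J → proj₁ mJ u v u∈J v∈J (exchange-Edge mI iI₁ ex)
    ... | no v∉J | yes u∈J =
      reroute seq₁ refl (exchange-maximum mI iI₁ ex) (proj₁ mI) (exchange-sym ex) v∉J u∈J
    ... | no v∉J | no u∉J = ⊥-elim (no-exchange-outside bip mI iI₁ ex mJ (u∉J , v∉J))

    shortest : MaximumIndependent π I → ReconfSeq π I J ℓ → ReconfSeq π I J ∣ I ─ J ∣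
    shortest _  (done iJ)         = subst (ReconfSeq π J J) (sym (∣p─p∣≡0 J)) (done iJ)
    shortest mI (step _ st rest) =
      let _ , _ , ex = step⇒exchange st
          iI₁ = ReconfSeq⇒Independent rest
      in extend mI iI₁ ex (shortest (exchange-maximum mI iI₁ ex) rest)

theorem2 : (n : ℕ) (π : Permutation′ n) → Bipartite π →
    (I J : Subset n) → MaximumIndependent π I → MaximumIndependent π J →
    Σ ℕ (λ ℓ → ReconfSeq π I J ℓ) →
    ReconfSeq π I J ∣ I ─ J ∣
theorem2 n π bip I J mI mJ (_ , seq) = shortest π bip mJ mI seq
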